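{- Let $n\ge1$. For every $D\in\mathrm{zLD}^2(n)$ we have $\phi(\psi(D))=D$.
   Context: $\mathrm{zLD}^2(n)$ is the set of pairs of sequences $(a,b)$ of positive integers of length $n$ with $a_i<a_{i+1}$ or $b_i<b_{i+1}$ for each $1\le i\le n-1$. Vertices $u,v$ with labels $w$ and levels $\mathrm{lv}$ are compatible, $u\bowtie v$, if ($\mathrm{lv}(u)<\mathrm{lv}(v)$ and $w(u)<w(v)$) or ($\mathrm{lv}(u)>\mathrm{lv}(v)$ and $w(u)>w(v)$). The construction $\psi(D)$ for $D=(a,b)$: take vertices $v_0$ (the root, $w(v_0)=\mathrm{lv}(v_0)=0$) and $v_1,\dots,v_n$ with $w(v_i)=a_{n+1-i}$ and $\mathrm{lv}(v_i)=L+l-b_{n+1-i}$, where $L=\max_i b_i$, $l=\min_i b_i$. Define the total order $\prec_*$ on $v_1,\dots,v_n$: $v_i\prec_*v_j$ if $w(v_i)<w(v_j)$, or $w(v_i)=w(v_j)$ and $\mathrm{lv}(v_i)>\mathrm{lv}(v_j)$, or $w(v_i)=w(v_j)$, $\mathrm{lv}(v_i)=\mathrm{lv}(v_j)$ and $i<j$. Build the tree inductively: $T_0$ is the single vertex $v_0$; given $T_k$ on $v_0,\dots,v_k$ ($k<n$), let $v_{i_0}=v_0,\dots,v_{i_s}=v_k$ be the path from the root to $v_k$ in $T_k$, and obtain $T_{k+1}$ by making $v_{k+1}$ a child of $v_{i_m}$, where $m=\min\big(\{0\le j<s: v_{k+1}\bowtie v_{i_j},\ v_{k+1}\prec_* v_{i_{j+1}}\}\cup\{s\}\big)$.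 Then $\psi(D)=T_n$; it is a tiered rooted tree with no inversions. The map $\phi$ on such a tree $T$ (root $r$, labels $w$, levels $\mathrm{lv}$): explore $T$ depth-first (preorder) from the root, where children of a vertex are visited in decreasing order of label, and among equal labels in increasing order of level. Let $u_0=r,u_1,\dots,u_n$ be the visiting order; with $L,l$ the max and min level over non-root vertices, set $\mathrm{lv}'(u)=L+l-\mathrm{lv}(u)$, and $\phi(T)=(a',b')$ with $a'_i=w(u_{n+1-i})$, $b'_i=\mathrm{lv}'(u_{n+1-i})$ for $i\in[n]$. -}

module Defs where

open import Data.Nat using (ℕ; zero; suc; _+_; _∸_; _<_; _≤_; _⊓_; _⊔_; _≡ᵇ_; _<ᵇ_; _≟_)
open import Data.Bool using (Bool; true; false; _∧_; _∨_; if_then_else_)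
open import Data.List using (List; []; _∷_; _++_; map; reverse; length; filter; concatMap; foldr; upTo)
open import Data.List.Relation.Unary.All using (All)
open import Data.Product using (_×_; _,_)
open import Data.Sum using (_⊎_)
open import Relation.Binary.PropositionalEquality using (_≡_)
open import Relation.Nullary.Decidable using (yes; no)

-- i-th entry (0-based), 0 if out of range
at : List ℕ → ℕ → ℕ
at []       _       = 0
at (x ∷ xs) zero    = x
at (x ∷ xs) (suc i) = at xs i

maxL : List ℕ → ℕ
maxL []       = 0
maxL (x ∷ xs) = foldr _⊔_ x xs

minL : List ℕ → ℕ
minL []       = 0
minL (x ∷ xs) = foldr _⊓_ x xs

data Ascent : List ℕ → List ℕ → Set where
  asc-nil   : Ascent [] []
  asc-one   : ∀ x y → Ascent (x ∷ []) (y ∷ [])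
  asc-cons  : ∀ x x′ y y′ xs ys →
              (x < x′ ⊎ y < y′) →
              Ascent (x′ ∷ xs) (y′ ∷ ys) →
              Ascent (x ∷ x′ ∷ xs) (y ∷ y′ ∷ ys)

record zLD2 (n : ℕ) (a b : List ℕ) : Set where
  field
    len-a  : length a ≡ n
    len-b  : length b ≡ n
    pos-a  : All (1 ≤_) a
    pos-b  : All (1 ≤_) b
    ascent : Ascent a b

-- Labelled rooted trees on vertices 0,1,…,n with root 0.
-- par is the list of parents of vertices 1,…,n (in that order).

record Tree : Set where
  field
    size : ℕ              -- n (number of non-root vertices)
    w    : ℕ → ℕ          -- labels  (w 0 = 0 for the root)
    lv   : ℕ → ℕ          -- levels  (lv 0 = 0 for the root)
    par  : List ℕ

parentOf : List ℕ → ℕ → ℕ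
parentOf par i = at par (i ∸ 1)

-- path from the root 0 to vertex k (fuel suffices when parents have
-- smaller index, which holds for all trees built below)
pathTo : List ℕ → ℕ → ℕ → List ℕ
pathTo par _        zero    = 0 ∷ []
pathTo par zero     (suc k) = 0 ∷ suc k ∷ []
pathTo par (suc f)  (suc k) = pathTo par f (parentOf par (suc k)) ++ (suc k ∷ [])

module Psi (a b : List ℕ) where
  n : ℕ
  n = length a

  L l : ℕ
  L = maxL b
  l = minL b

  wψ : ℕ → ℕ
  wψ zero    = 0
  wψ (suc i) = at (reverse a) i

  lvψ : ℕ → ℕ
  lvψ zero    = 0
  lvψ (suc i) = (L + l) ∸ at (reverse b) i

  compat : ℕ → ℕ → Bool
  compat u v = ((lvψ u <ᵇ lvψ v) ∧ (wψ u <ᵇ wψ v))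
             ∨ ((lvψ v <ᵇ lvψ u) ∧ (wψ v <ᵇ wψ u))

  prec : ℕ → ℕ → Bool
  prec i j = (wψ i <ᵇ wψ j)
           ∨ ((wψ i ≡ᵇ wψ j) ∧ (lvψ j <ᵇ lvψ i))
           ∨ ((wψ i ≡ᵇ wψ j) ∧ (lvψ i ≡ᵇ lvψ j) ∧ (i <ᵇ j))

  choose : ℕ → List ℕ → ℕ
  choose v []            = 0
  choose v (x ∷ [])      = x
  choose v (x ∷ y ∷ ys)  =
    if compat v x ∧ prec v y then x else choose v (y ∷ ys)

  build : ℕ → List ℕ
  build zero    = []
  build (suc k) = let p = build k in
                  p ++ (choose (suc k) (pathTo p k k) ∷ [])

  tree : Tree
  tree = record { size = n ; w = wψ ; lv = lvψ ; par = build n }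

ψ : List ℕ → List ℕ → Tree
ψ a b = Psi.tree a b

module Phi (T : Tree) where
  open Tree T

  before : ℕ → ℕ → Bool
  before u v = (w v <ᵇ w u)
             ∨ ((w u ≡ᵇ w v) ∧ (lv u <ᵇ lv v))
             ∨ ((w u ≡ᵇ w v) ∧ (lv u ≡ᵇ lv v) ∧ (u <ᵇ v))

  insert : ℕ → List ℕ → List ℕ
  insert u []       = u ∷ []
  insert u (v ∷ vs) = if before u v then u ∷ v ∷ vs else v ∷ insert u vs

  sortC : List ℕ → List ℕ
  sortC = foldr insert []

  nonRoot : List ℕ
  nonRoot = map suc (upTo size)

  children : ℕ → List ℕ
  children u = sortC (filter (λ v → parentOf par v ≟ u) nonRoot)

  dfs : ℕ → ℕ → List ℕ
  dfs zero     u = u ∷ []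
  dfs (suc f)  u = u ∷ concatMap (dfs f) (children u)

  visit : List ℕ
  visit with dfs (suc size) 0
  ... | []     = []
  ... | _ ∷ us = us

  Lφ lφ : ℕ
  Lφ = maxL (map lv visit)
  lφ = minL (map lv visit)

  lv′ : ℕ → ℕ
  lv′ u = (Lφ + lφ) ∸ lv u

  result : List ℕ × List ℕ
  result = reverse (map w visit) , reverse (map lv′ visit)

φ : Tree → List ℕ × List ℕ
φ = Phi.result

-- ψ inserts v₁, …, vₙ one at a time, each as a child of a vertex on the path from the root
-- to the previously inserted vertex, and φ lists the vertices in depth-first preorder.  The
-- point is that this preorder is v₁, …, vₙ itself.  The construction keeps four invariants:
-- parents precede their children; every vertex inserted after an ancestor x of the newest
-- vertex lies below x; subtrees are nested; and siblings are inserted in the order in which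
-- φ visits them.  Consequently every subtree is an interval of indices,
-- split by the children into consecutive subtree intervals, and the search visits 1, …, n
-- in order.  φ then reads the labels and levels of vₙ, …, v₁, undoing the reversal in ψ;
-- the levels L + l − bᵢ have maximum L + l − l and minimum L + l − L, so renormalising
-- them restores b.
{-# OPTIONS --safe #-}
module Submission where

open import Defs
open import Data.Nat
open import Data.Nat.Properties
open import Data.Nat.Induction using (<-wellFounded)
open import Data.Bool using (true; false; T; _∧_; _∨_)
open import Data.Bool.Properties using (T-≡; T-∨; T-∧)
open import Data.List using (List; []; _∷_; _++_; map; reverse; length; filter; concatMap; upTo; applyUpTo)
open import Data.List.Properties
  using (map-cong; map-∘; foldr-preservesᵇ; foldr-preservesʳ; foldr-forcesᵇ; length-++; length-reverse; reverse-involutive;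
         reverse-map; filter-++; filter-accept; filter-reject; filter-none; ++-identityʳ; ∷-injectiveʳ)
open import Data.List.Membership.Propositional using (_∈_)
open import Data.List.Membership.Propositional.Properties using (∈-filter⁻)
open import Data.List.Relation.Unary.All as All using (All; []; _∷_)
open import Data.List.Relation.Unary.Any using (here; there)
open import Data.List.Relation.Unary.AllPairs using (AllPairs; []; _∷_)
open import Data.List.Relation.Binary.Permutation.Propositional using (_↭_; ↭-sym)
open import Data.List.Relation.Binary.Permutation.Propositional.Properties using (All-resp-↭; ↭-empty-inv; ¬x∷xs↭[]; ↭-reverse)
open import Data.Product using (_×_; _,_; proj₁; proj₂; ∃-syntax)
open import Data.Product.Relation.Binary.Lex.Strict using (×-Lex; ×-transitive)
open import Data.Sum as Sum using (_⊎_; inj₁; inj₂)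
open import Data.Empty using (⊥-elim)
open import Function using (id; _∘_; flip; Equivalence)
open import Induction.WellFounded using (Acc; acc)
open import Relation.Binary using (tri<; tri≈; tri>)
open import Relation.Binary.Construct.Closure.ReflexiveTransitive using (Star; ε; _◅_; _◅◅_)
open import Relation.Binary.PropositionalEquality
  using (_≡_; _≢_; refl; sym; trans; cong; cong₂; subst; resp₂; isEquivalence; module ≡-Reasoning)
open import Relation.Nullary using (¬_; yes; no)
open import Relation.Unary using (Decidable)

range : ℕ → ℕ → List ℕ
range s zero    = []
range s (suc m) = s ∷ range (suc s) m

[_⋯_⟩ : ℕ → ℕ → List ℕ
[ i ⋯ k ⟩ = range i (k ∸ i)

range-++ : ∀ s m k → range s m ++ range (s + m) k ≡ range s (m + k)
range-++ s zero    k rewrite +-identityʳ s = refl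
range-++ s (suc m) k rewrite +-suc s m = cong (s ∷_) (range-++ (suc s) m k)

∈-range⁻ : ∀ {v} s m → v ∈ range s m → s ≤ v × v < s + m
∈-range⁻ s (suc m) (here refl) = ≤-refl , m<m+n s z<s
∈-range⁻ {v} s (suc m) (there v∈) with ∈-range⁻ (suc s) m v∈
... | s<v , v<s+m = <⇒≤ s<v , subst (v <_) (sym (+-suc s m)) v<s+m

map-range-suc : ∀ (f : ℕ → ℕ) s m → map f (range (suc s) m) ≡ map (f ∘ suc) (range s m)
map-range-suc f s zero    = refl
map-range-suc f s (suc m) = cong (f (suc s) ∷_) (map-range-suc f (suc s) m)

map-at-range : ∀ xs → map (at xs) (range 0 (length xs)) ≡ xs
map-at-range []       = refl
map-at-range (x ∷ xs) = cong (x ∷_) (trans (map-range-suc (at (x ∷ xs)) 0 (length xs)) (map-at-range xs))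

map-range-at : ∀ {g : ℕ → ℕ} xs → (∀ i → g (suc i) ≡ at xs i) → map g (range 1 (length xs)) ≡ xs
map-range-at {g} xs g≗ = begin
  map g (range 1 (length xs))            ≡⟨ map-range-suc g 0 (length xs) ⟩
  map (g ∘ suc) (range 0 (length xs))    ≡⟨ map-cong g≗ _ ⟩
  map (at xs) (range 0 (length xs))      ≡⟨ map-at-range xs ⟩
  xs                                     ∎
  where open ≡-Reasoning

map-suc-upTo : ∀ n → map suc (upTo n) ≡ range 1 n
map-suc-upTo n = shifted id 0 n (λ _ → refl)
  where
  shifted : ∀ (f : ℕ → ℕ) s n → (∀ i → f i ≡ s + i) → map suc (applyUpTo f n) ≡ range (suc s) n
  shifted f s zero    _  = refl
  shifted f s (suc n) f≗ = cong₂ _∷_ (cong suc (trans (f≗ 0) (+-identityʳ s)))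
                                     (shifted (f ∘ suc) (suc s) n (λ i → trans (f≗ (suc i)) (+-suc s i)))

interval-head : ∀ {i k} → i < k → [ i ⋯ k ⟩ ≡ i ∷ [ suc i ⋯ k ⟩
interval-head {i} {suc k} (s≤s i≤k) rewrite +-∸-assoc 1 i≤k = refl

interval-empty : ∀ i → [ i ⋯ i ⟩ ≡ []
interval-empty i rewrite n∸n≡0 i = refl

interval-++ : ∀ {i j k} → i ≤ j → j ≤ k → [ i ⋯ j ⟩ ++ [ j ⋯ k ⟩ ≡ [ i ⋯ k ⟩
interval-++ {i} {j} {k} i≤j j≤k = begin
  range i (j ∸ i) ++ range j (k ∸ j)
    ≡⟨ cong (λ s → range i (j ∸ i) ++ range s (k ∸ j)) (m+[n∸m]≡n i≤j) ⟨
  range i (j ∸ i) ++ range (i + (j ∸ i)) (k ∸ j) ≡⟨ range-++ i (j ∸ i) (k ∸ j) ⟩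
  range i ((j ∸ i) + (k ∸ j))                    ≡⟨ cong (range i) length≡ ⟩
  range i (k ∸ i)                                ∎
  where
  open ≡-Reasoning
  length≡ : (j ∸ i) + (k ∸ j) ≡ k ∸ i
  length≡ = begin
    (j ∸ i) + (k ∸ j) ≡⟨ +-∸-comm (k ∸ j) i≤j ⟨
    (j + (k ∸ j)) ∸ i ≡⟨ cong (_∸ i) (m+[n∸m]≡n j≤k) ⟩
    k ∸ i             ∎

interval-end : ∀ {i k v} → i ≤ v → v < i + (k ∸ i) → v < k
interval-end {i} {k} {v} i≤v v<end with i ≤? k
... | yes i≤k = subst (v <_) (m+[n∸m]≡n i≤k) v<end
... | no  i≰k rewrite m≤n⇒m∸n≡0 (<⇒≤ (≰⇒> i≰k)) | +-identityʳ i = ⊥-elim (<⇒≱ v<end i≤v)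

∈-interval⁻ : ∀ {v} i k → v ∈ [ i ⋯ k ⟩ → i ≤ v × v < k
∈-interval⁻ i k v∈ = let i≤v , v<end = ∈-range⁻ i (k ∸ i) v∈ in i≤v , interval-end i≤v v<end

range-allPairs : ∀ {R : ℕ → ℕ → Set} s m → (∀ {c c′} → s ≤ c → c < c′ → c′ < s + m → R c c′) →
                 AllPairs R (range s m)
range-allPairs s zero    R-in = []
range-allPairs s (suc m) R-in =
  All.tabulate (λ c′∈ → let s<c′ , c′<end = ∈-range⁻ (suc s) m c′∈ in R-in ≤-refl s<c′ (shift c′<end))
  ∷ range-allPairs (suc s) m (λ s<c c<c′ c′<end → R-in (<⇒≤ s<c) c<c′ (shift c′<end))
  where
  shift : ∀ {v} → v < suc s + m → v < s + suc m
  shift {v} = subst (v <_) (sym (+-suc s m))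

interval-allPairs : ∀ {R : ℕ → ℕ → Set} i k → (∀ {c c′} → i ≤ c → c < c′ → c′ < k → R c c′) →
                    AllPairs R [ i ⋯ k ⟩
interval-allPairs i k R-in =
  range-allPairs i (k ∸ i) (λ i≤c c<c′ c′<end → R-in i≤c c<c′ (interval-end (≤-trans i≤c (<⇒≤ c<c′)) c′<end))

at-++ˡ : ∀ xs ys {i} → i < length xs → at (xs ++ ys) i ≡ at xs i
at-++ˡ (x ∷ xs) ys {zero}  _         = refl
at-++ˡ (x ∷ xs) ys {suc i} (s≤s i<n) = at-++ˡ xs ys i<n

at-++-length : ∀ xs y ys → at (xs ++ y ∷ ys) (length xs) ≡ y
at-++-length []       y ys = refl
at-++-length (x ∷ xs) y ys = at-++-length xs y ys

at-All : ∀ {P : ℕ → Set} {xs} → P 0 → All P xs → ∀ i → P (at xs i)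
at-All P0 []         i       = P0
at-All P0 (px ∷ pxs) zero    = px
at-All P0 (px ∷ pxs) (suc i) = at-All P0 pxs i

maxL-ub : ∀ xs → All (_≤ maxL xs) xs
maxL-ub []       = []
maxL-ub (x ∷ xs) =
  foldr-preservesʳ {P = x ≤_} (λ y → m≤n⇒m≤o⊔n y) ≤-refl xs
  ∷ foldr-forcesᵇ {P = _≤ maxL (x ∷ xs)} (λ y z y⊔z≤ → m⊔n≤o⇒m≤o y z y⊔z≤ , m⊔n≤o⇒n≤o y z y⊔z≤)
                  x xs ≤-refl

maxL-lub : ∀ {m xs} → All (_≤ m) xs → maxL xs ≤ m
maxL-lub []         = z≤n
maxL-lub (x≤m ∷ xs≤m) = foldr-preservesᵇ ⊔-lub x≤m xs≤m

minL-lb : ∀ xs → All (minL xs ≤_) xs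
minL-lb []       = []
minL-lb (x ∷ xs) =
  foldr-preservesʳ {P = _≤ x} (λ y → m≤n⇒o⊓m≤n y) ≤-refl xs
  ∷ foldr-forcesᵇ {P = minL (x ∷ xs) ≤_} (λ y z ≤y⊓z → m≤n⊓o⇒m≤n y z ≤y⊓z , m≤n⊓o⇒m≤o y z ≤y⊓z)
                  x xs ≤-refl

minL-glb : ∀ {m x xs} → All (m ≤_) (x ∷ xs) → m ≤ minL (x ∷ xs)
minL-glb (m≤x ∷ m≤xs) = foldr-preservesᵇ ⊓-glb m≤x m≤xs

maxL-↭ : ∀ {xs ys} → xs ↭ ys → maxL xs ≡ maxL ys
maxL-↭ {xs} {ys} xs↭ys = ≤-antisym (maxL-lub (All-resp-↭ (↭-sym xs↭ys) (maxL-ub ys)))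
                                   (maxL-lub (All-resp-↭ xs↭ys (maxL-ub xs)))

minL-↭ : ∀ {xs ys} → xs ↭ ys → minL xs ≡ minL ys
minL-↭ {[]}    {ys}     xs↭ys rewrite ↭-empty-inv (↭-sym xs↭ys) = refl
minL-↭ {_ ∷ _} {[]}     xs↭ys = ⊥-elim (¬x∷xs↭[] xs↭ys)
minL-↭ {x ∷ xs} {y ∷ ys} xs↭ys = ≤-antisym (minL-glb (All-resp-↭ xs↭ys (minL-lb (x ∷ xs))))
                                           (minL-glb (All-resp-↭ (↭-sym xs↭ys) (minL-lb (y ∷ ys))))

maxL-map-∸ : ∀ c x xs → maxL (map (c ∸_) (x ∷ xs)) ≡ c ∸ minL (x ∷ xs)
maxL-map-∸ c x []       = refl
maxL-map-∸ c x (y ∷ ys) = trans (cong ((c ∸ y) ⊔_) (maxL-map-∸ c x ys)) (sym (∸-distribˡ-⊓-⊔ c y _))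

minL-map-∸ : ∀ c x xs → minL (map (c ∸_) (x ∷ xs)) ≡ c ∸ maxL (x ∷ xs)
minL-map-∸ c x []       = refl
minL-map-∸ c x (y ∷ ys) = trans (cong ((c ∸ y) ⊓_) (minL-map-∸ c x ys)) (sym (∸-distribˡ-⊔-⊓ c y _))

run-end : ∀ {Q : ℕ → Set} → Decidable Q → ∀ j e → j ≤ e →
          ∃[ k ] j ≤ k × k ≤ e × (∀ {v} → j ≤ v → v < k → Q v) × (k < e → ¬ Q k)
run-end Q? j e j≤e with m≤n⇒m<n∨m≡n j≤e
run-end Q? j e j≤e | inj₂ refl =
  j , ≤-refl , ≤-refl , (λ j≤v v<j → ⊥-elim (<⇒≱ v<j j≤v)) , (λ j<j → ⊥-elim (<-irrefl refl j<j))
run-end {Q} Q? j (suc e) _ | inj₁ (s≤s j≤e) with run-end Q? j e j≤e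
... | k , j≤k , k≤e , run , stop with m≤n⇒m<n∨m≡n k≤e
...   | inj₁ k<e  = k , j≤k , m≤n⇒m≤1+n k≤e , run , (λ _ → stop k<e)
...   | inj₂ refl with Q? k
...     | no ¬q = k , j≤k , n≤1+n k , run , (λ _ → ¬q)
...     | yes q = suc k , m≤n⇒m≤1+n j≤k , ≤-refl , run′ , (λ k<k → ⊥-elim (<-irrefl refl k<k))
  where
  run′ : ∀ {v} → j ≤ v → v < suc k → Q v
  run′ j≤v v≤k with m≤n⇒m<n∨m≡n (≤-pred v≤k)
  ... | inj₁ v<k = run j≤v v<k
  ... | inj₂ refl = q

module Preorder (tr : Tree) where
  open Tree tr
  open Phi tr

  parent : ℕ → ℕ
  parent = parentOf par

  childrenIn : ℕ → List ℕ → List ℕ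
  childrenIn u = filter (λ v → parent v ≟ u)

  insert-least : ∀ {u vs} → All (λ v → T (before u v)) vs → insert u vs ≡ u ∷ vs
  insert-least []                                = refl
  insert-least {u} {v ∷ vs} (u-before-v ∷ _) rewrite Equivalence.to T-≡ u-before-v = refl

  childrenIn-only : ∀ {u} xs ys zs → childrenIn u xs ≡ [] → childrenIn u zs ≡ [] →
                    childrenIn u (xs ++ ys ++ zs) ≡ childrenIn u ys
  childrenIn-only {u} xs ys zs none-xs none-zs
    rewrite filter-++ (λ v → parent v ≟ u) xs (ys ++ zs) | filter-++ (λ v → parent v ≟ u) ys zs
          | none-xs | none-zs = ++-identityʳ _

  childrenIn-none : ∀ {u i k} → (∀ {v} → i ≤ v → v < k → parent v ≢ u) → childrenIn u [ i ⋯ k ⟩ ≡ []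
  childrenIn-none {u} {i} {k} not-child = filter-none (λ v → parent v ≟ u)
    (All.tabulate (λ v∈ → let i≤v , v<k = ∈-interval⁻ i k v∈ in not-child i≤v v<k))

  IncreasingVertices : List ℕ → Set
  IncreasingVertices = AllPairs (λ c c′ → 1 ≤ c × c < c′ × c′ ≤ size)

  interval-increasing : ∀ {i k} → 1 ≤ i → k ≤ suc size → IncreasingVertices [ i ⋯ k ⟩
  interval-increasing {i} {k} 1≤i k≤ =
    interval-allPairs i k (λ i≤c c<c′ c′<k → ≤-trans 1≤i i≤c , c<c′ , ≤-pred (≤-trans c′<k k≤))

  -- The subtree rooted at u consists of the vertices u, u + 1, …, e − 1.
  record SubtreeSpan (u e : ℕ) : Set where
    field
      root<end : u < e
      end≤     : e ≤ suc size
      inside   : ∀ {v} → u < v → v < e → u ≤ parent v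
      exit     : e ≤ size → parent e < u

  -- The vertices j, …, e − 1 form the subtrees of consecutive children of u, the first being j.
  record ForestSpan (u j e : ℕ) : Set where
    field
      parent<start : u < j
      start≤end    : j ≤ e
      end≤         : e ≤ suc size
      inside       : ∀ {v} → j ≤ v → v < e → u ≤ parent v
      first        : j < e → parent j ≡ u
      exit         : e ≤ size → parent e < u

  record IsPreorderNumbering : Set where
    field
      parent-<        : ∀ {v} → 1 ≤ v → v ≤ size → parent v < v
      nested          : ∀ {v j} → 1 ≤ v → v < j → j ≤ size → parent j < v → parent j ≤ parent v
      siblings-before : ∀ {c c′} → 1 ≤ c → c < c′ → c′ ≤ size → parent c ≡ parent c′ → T (before c c′)

  module _ (numbering : IsPreorderNumbering) where
    open IsPreorderNumbering numbering
    open SubtreeSpan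
    open ForestSpan

    sortC-childrenIn : ∀ {u vs} → IncreasingVertices vs → sortC (childrenIn u vs) ≡ childrenIn u vs
    sortC-childrenIn [] = refl
    sortC-childrenIn {u} {v ∷ vs} (v<vs ∷ vs-increasing) with parent v ≟ u
    ... | no  pv≢u = begin
      sortC (childrenIn u (v ∷ vs)) ≡⟨ cong sortC (filter-reject (λ c → parent c ≟ u) pv≢u) ⟩
      sortC (childrenIn u vs)       ≡⟨ sortC-childrenIn vs-increasing ⟩
      childrenIn u vs               ≡⟨ filter-reject (λ c → parent c ≟ u) pv≢u ⟨
      childrenIn u (v ∷ vs)         ∎
      where open ≡-Reasoning
    ... | yes pv≡u = begin
      sortC (childrenIn u (v ∷ vs))   ≡⟨ cong sortC (filter-accept (λ c → parent c ≟ u) pv≡u) ⟩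
      insert v (sortC (childrenIn u vs)) ≡⟨ cong (insert v) (sortC-childrenIn vs-increasing) ⟩
      insert v (childrenIn u vs)      ≡⟨ insert-least (All.tabulate before-sibling) ⟩
      v ∷ childrenIn u vs             ≡⟨ filter-accept (λ c → parent c ≟ u) pv≡u ⟨
      childrenIn u (v ∷ vs)           ∎
      where
      open ≡-Reasoning
      before-sibling : ∀ {c} → c ∈ childrenIn u vs → T (before v c)
      before-sibling c∈ with ∈-filter⁻ (λ c → parent c ≟ u) c∈
      ... | c∈vs , pc≡u with All.lookup v<vs c∈vs
      ...   | 1≤v , v<c , c≤size = siblings-before 1≤v v<c c≤size (trans pv≡u (sym pc≡u))

    not-child-of-later : ∀ {u v} → 1 ≤ v → v ≤ u → u ≤ size → parent v ≢ u
    not-child-of-later {u} {v} 1≤v v≤u u≤size pv≡u =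
      <⇒≱ (parent-< 1≤v (≤-trans v≤u u≤size)) (subst (v ≤_) (sym pv≡u) v≤u)

    not-child-beyond-exit : ∀ {u e v} → u < e → (e ≤ size → parent e < u) → e ≤ v → v ≤ size → parent v ≢ u
    not-child-beyond-exit {u} {e} {v} u<e exit-e e≤v v≤size pv≡u with m≤n⇒m<n∨m≡n e≤v
    ... | inj₂ refl = <-irrefl pv≡u (exit-e v≤size)
    ... | inj₁ e<v  = <-irrefl pv≡u (≤-<-trans pv≤pe (exit-e (≤-trans (<⇒≤ e<v) v≤size)))
      where
      pv≤pe : parent v ≤ parent e
      pv≤pe = nested (≤-trans (s≤s z≤n) u<e) e<v v≤size (subst (_< e) (sym pv≡u) u<e)

    children-subtree : ∀ {u e} → SubtreeSpan u e → children u ≡ childrenIn u [ suc u ⋯ e ⟩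
    children-subtree {u} {e} span = begin
      sortC (childrenIn u (map suc (upTo size)))
        ≡⟨ cong (sortC ∘ childrenIn u) vertices-split ⟩
      sortC (childrenIn u ([ 1 ⋯ suc u ⟩ ++ [ suc u ⋯ e ⟩ ++ [ e ⋯ suc size ⟩))
        ≡⟨ cong sortC (childrenIn-only [ 1 ⋯ suc u ⟩ _ [ e ⋯ suc size ⟩
                                       (childrenIn-none earlier) (childrenIn-none later)) ⟩
      sortC (childrenIn u [ suc u ⋯ e ⟩)
        ≡⟨ sortC-childrenIn (interval-increasing (s≤s z≤n) (end≤ span)) ⟩
      childrenIn u [ suc u ⋯ e ⟩ ∎
      where
      open ≡-Reasoning
      u≤size : u ≤ size
      u≤size = ≤-pred (≤-trans (root<end span) (end≤ span))
      vertices-split : map suc (upTo size) ≡ [ 1 ⋯ suc u ⟩ ++ [ suc u ⋯ e ⟩ ++ [ e ⋯ suc size ⟩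
      vertices-split = begin
        map suc (upTo size)                                      ≡⟨ map-suc-upTo size ⟩
        [ 1 ⋯ suc size ⟩                                          ≡⟨ interval-++ (s≤s z≤n) (s≤s u≤size) ⟨
        [ 1 ⋯ suc u ⟩ ++ [ suc u ⋯ suc size ⟩
          ≡⟨ cong ([ 1 ⋯ suc u ⟩ ++_) (interval-++ (root<end span) (end≤ span)) ⟨
        [ 1 ⋯ suc u ⟩ ++ [ suc u ⋯ e ⟩ ++ [ e ⋯ suc size ⟩        ∎
      earlier : ∀ {v} → 1 ≤ v → v < suc u → parent v ≢ u
      earlier 1≤v v<su = not-child-of-later 1≤v (≤-pred v<su) u≤size
      later : ∀ {v} → e ≤ v → v < suc size → parent v ≢ u
      later e≤v v<ss = not-child-beyond-exit (root<end span) (exit span) e≤v (≤-pred v<ss)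

    subtree⇒forest : ∀ {u e} → SubtreeSpan u e → ForestSpan u (suc u) e
    subtree⇒forest {u} span = record
      { parent<start = ≤-refl
      ; start≤end    = root<end span
      ; end≤         = end≤ span
      ; inside       = λ u<v v<e → inside span u<v v<e
      ; first        = λ u+1<e → ≤-antisym (≤-pred (parent-< (s≤s z≤n) (≤-pred (≤-trans u+1<e (end≤ span)))))
                                           (inside span ≤-refl u+1<e)
      ; exit         = exit span
      }

    forest-split : ∀ {u j e} → ForestSpan u j e → j < e → ∃[ k ] SubtreeSpan j k × ForestSpan u k e
    forest-split {u} {j} {e} span j<e with run-end (λ v → j ≤? parent v) (suc j) e j<e
    ... | k , j<k , k≤e , run , stop = k , tree , rest
      where
      exit-j : k ≤ size → parent k < j
      exit-j k≤size with m≤n⇒m<n∨m≡n k≤e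
      ... | inj₁ k<e  = ≰⇒> (stop k<e)
      ... | inj₂ refl = <-trans (exit span k≤size) (parent<start span)
      tree : SubtreeSpan j k
      tree = record { root<end = j<k ; end≤ = ≤-trans k≤e (end≤ span) ; inside = run ; exit = exit-j }
      parent-k≤u : k < e → parent k ≤ u
      parent-k≤u k<e = subst (parent k ≤_) (first span j<e)
        (nested (≤-trans (s≤s z≤n) (parent<start span)) j<k k≤size (exit-j k≤size))
        where
        k≤size : k ≤ size
        k≤size = ≤-pred (≤-trans k<e (end≤ span))
      rest : ForestSpan u k e
      rest = record
        { parent<start = <-trans (parent<start span) j<k
        ; start≤end    = k≤e
        ; end≤         = end≤ span
        ; inside       = λ k≤v v<e → inside span (≤-trans (<⇒≤ j<k) k≤v) v<e
        ; first        = λ k<e → ≤-antisym (parent-k≤u k<e) (inside span (<⇒≤ j<k) k<e)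
        ; exit         = exit span
        }

    childrenIn-forest : ∀ {u j k e} → ForestSpan u j e → SubtreeSpan j k → k ≤ e → j < e →
                        childrenIn u [ j ⋯ e ⟩ ≡ j ∷ childrenIn u [ k ⋯ e ⟩
    childrenIn-forest {u} {j} {k} {e} span tree k≤e j<e = begin
      childrenIn u [ j ⋯ e ⟩                            ≡⟨ cong (childrenIn u) (interval-head j<e) ⟩
      childrenIn u (j ∷ [ suc j ⋯ e ⟩)                  ≡⟨ filter-accept (λ v → parent v ≟ u) (first span j<e) ⟩
      j ∷ childrenIn u [ suc j ⋯ e ⟩
        ≡⟨ cong (λ vs → j ∷ childrenIn u vs) (interval-++ (root<end tree) k≤e) ⟨
      j ∷ childrenIn u ([ suc j ⋯ k ⟩ ++ [ k ⋯ e ⟩)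
        ≡⟨ cong (j ∷_) (filter-++ (λ v → parent v ≟ u) [ suc j ⋯ k ⟩ _) ⟩
      j ∷ childrenIn u [ suc j ⋯ k ⟩ ++ childrenIn u [ k ⋯ e ⟩
        ≡⟨ cong (λ vs → j ∷ vs ++ childrenIn u [ k ⋯ e ⟩) (childrenIn-none grandchild) ⟩
      j ∷ childrenIn u [ k ⋯ e ⟩                        ∎
      where
      open ≡-Reasoning
      grandchild : ∀ {v} → suc j ≤ v → v < k → parent v ≢ u
      grandchild j<v v<k pv≡u = <⇒≱ (parent<start span) (subst (j ≤_) pv≡u (inside tree j<v v<k))

    dfs-subtree : ∀ {u e} f → SubtreeSpan u e → e ∸ u ≤ f → dfs f u ≡ [ u ⋯ e ⟩
    dfs-forest  : ∀ {u j e} f → ForestSpan u j e → e ∸ j ≤ f → Acc _<_ (e ∸ j) →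
                  concatMap (dfs f) (childrenIn u [ j ⋯ e ⟩) ≡ [ j ⋯ e ⟩

    dfs-subtree {u} {e} zero    span fuel = ⊥-elim (<⇒≱ (m<n⇒0<n∸m (root<end span)) fuel)
    dfs-subtree {u} {e} (suc f) span fuel = begin
      u ∷ concatMap (dfs f) (children u)
        ≡⟨ cong (λ vs → u ∷ concatMap (dfs f) vs) (children-subtree span) ⟩
      u ∷ concatMap (dfs f) (childrenIn u [ suc u ⋯ e ⟩)
        ≡⟨ cong (u ∷_) (dfs-forest f (subtree⇒forest span) fuel′ (<-wellFounded _)) ⟩
      u ∷ [ suc u ⋯ e ⟩                                   ≡⟨ interval-head (root<end span) ⟨
      [ u ⋯ e ⟩                                           ∎
      where
      open ≡-Reasoning
      fuel′ : e ∸ suc u ≤ f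
      fuel′ = subst (_≤ f) (pred[m∸n]≡m∸[1+n] e u) (pred-mono-≤ fuel)

    dfs-forest {u} {j} {e} f span fuel (acc smaller) with m≤n⇒m<n∨m≡n (start≤end span)
    ... | inj₂ refl rewrite interval-empty j = refl
    ... | inj₁ j<e with forest-split span j<e
    ...   | k , tree , rest = begin
      concatMap (dfs f) (childrenIn u [ j ⋯ e ⟩)         ≡⟨ cong (concatMap (dfs f)) (childrenIn-forest span tree k≤e j<e) ⟩
      dfs f j ++ concatMap (dfs f) (childrenIn u [ k ⋯ e ⟩)
        ≡⟨ cong₂ _++_ (dfs-subtree f tree (≤-trans (∸-monoˡ-≤ j k≤e) fuel))
                      (dfs-forest f rest (≤-trans (∸-monoʳ-≤ e (<⇒≤ j<k)) fuel) (smaller (∸-monoʳ-< j<k k≤e))) ⟩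
      [ j ⋯ k ⟩ ++ [ k ⋯ e ⟩                             ≡⟨ interval-++ (<⇒≤ j<k) k≤e ⟩
      [ j ⋯ e ⟩                                          ∎
      where
      open ≡-Reasoning
      j<k : j < k
      j<k = root<end tree
      k≤e : k ≤ e
      k≤e = start≤end rest

    visit-preorder : visit ≡ [ 1 ⋯ suc size ⟩
    visit-preorder = ∷-injectiveʳ (dfs-subtree (suc size) whole-tree ≤-refl)
      where
      whole-tree : SubtreeSpan 0 (suc size)
      whole-tree = record
        { root<end = s≤s z≤n ; end≤ = ≤-refl ; inside = λ _ _ → z≤n ; exit = λ ss≤s → ⊥-elim (1+n≰n ss≤s) }

Lex₃ : ℕ × ℕ × ℕ → ℕ × ℕ × ℕ → Set
Lex₃ = ×-Lex _≡_ _>_ (×-Lex _≡_ _<_ _<_)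

Lex₃-trans : ∀ {x y z} → Lex₃ x y → Lex₃ y z → Lex₃ x z
Lex₃-trans = ×-transitive {_<₁_ = _>_} {_<₂_ = ×-Lex _≡_ _<_ _<_} isEquivalence (resp₂ _>_) (flip <-trans)
               (×-transitive {_<₁_ = _<_} {_<₂_ = _<_} isEquivalence (resp₂ _<_) <-trans <-trans)

T-lex₃ : ∀ {x₁ x₂ x₃ y₁ y₂ y₃} → Lex₃ (x₁ , x₂ , x₃) (y₁ , y₂ , y₃) →
         T ((y₁ <ᵇ x₁) ∨ ((x₁ ≡ᵇ y₁) ∧ (x₂ <ᵇ y₂)) ∨ ((x₁ ≡ᵇ y₁) ∧ (x₂ ≡ᵇ y₂) ∧ (x₃ <ᵇ y₃)))
T-lex₃ {x₁} {x₂} {x₃} {y₁} {y₂} {y₃} lex =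
  Equivalence.from T-∨ (Sum.map <⇒<ᵇ (λ tie → Equivalence.from T-∨ (tie-breaks tie)) lex)
  where
  tie-breaks : x₁ ≡ y₁ × (x₂ < y₂ ⊎ (x₂ ≡ y₂ × x₃ < y₃)) →
               T ((x₁ ≡ᵇ y₁) ∧ (x₂ <ᵇ y₂)) ⊎ T ((x₁ ≡ᵇ y₁) ∧ (x₂ ≡ᵇ y₂) ∧ (x₃ <ᵇ y₃))
  tie-breaks (x₁≡y₁ , inj₁ x₂<y₂)          = inj₁ (Equivalence.from T-∧ (≡⇒≡ᵇ _ _ x₁≡y₁ , <⇒<ᵇ x₂<y₂))
  tie-breaks (x₁≡y₁ , inj₂ (x₂≡y₂ , x₃<y₃)) =
    inj₂ (Equivalence.from T-∧ (≡⇒≡ᵇ _ _ x₁≡y₁ , Equivalence.from T-∧ (≡⇒≡ᵇ _ _ x₂≡y₂ , <⇒<ᵇ x₃<y₃)))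

module Construction (a b : List ℕ) where
  open Psi a b

  parent : ℕ → ℕ
  parent v = parentOf (build v) v

  length-build : ∀ k → length (build k) ≡ k
  length-build zero    = refl
  length-build (suc k) = trans (length-++ (build k)) (trans (+-comm (length (build k)) 1) (cong suc (length-build k)))

  parent-suc : ∀ k → parent (suc k) ≡ choose (suc k) (pathTo (build k) k k)
  parent-suc k = subst (λ i → at (build k ++ attached ∷ []) i ≡ attached) (length-build k)
                       (at-++-length (build k) attached [])
    where
    attached : ℕ
    attached = choose (suc k) (pathTo (build k) k k)

  build-stable : ∀ {k v} → 1 ≤ v → v ≤ k → parentOf (build k) v ≡ parent v
  build-stable {suc k} {suc v} _ v≤k with m≤n⇒m<n∨m≡n v≤k
  ... | inj₂ refl = refl
  ... | inj₁ v<k  = trans (at-++ˡ (build k) _ (subst (v <_) (sym (length-build k)) (≤-pred v<k)))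
                          (build-stable (s≤s z≤n) (≤-pred v<k))

  key : ℕ → ℕ × ℕ × ℕ
  key u = wψ u , lvψ u , u

  _⊏_ : ℕ → ℕ → Set
  u ⊏ v = Lex₃ (key u) (key v)

  ⊏-trans : ∀ {u v x} → u ⊏ v → v ⊏ x → u ⊏ x
  ⊏-trans = Lex₃-trans

  ⊏⇒before : ∀ {u v} → u ⊏ v → T (Phi.before (ψ a b) u v)
  ⊏⇒before = T-lex₃

  prec⇒⊏ : ∀ {v y} → T (prec v y) → y < v → y ⊏ v
  prec⇒⊏ {v} {y} v≺y y<v with Equivalence.to T-∨ v≺y
  ... | inj₁ wv<wy = inj₁ (<ᵇ⇒< _ _ wv<wy)
  ... | inj₂ tie with Equivalence.to T-∨ tie
  ...   | inj₁ lv-tie = let w≡ , lvy<lvv = Equivalence.to T-∧ lv-tie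
                        in inj₂ (sym (≡ᵇ⇒≡ _ _ w≡) , inj₁ (<ᵇ⇒< _ _ lvy<lvv))
  ...   | inj₂ full-tie = ⊥-elim (<-asym y<v (<ᵇ⇒< v y v<ᵇy))
    where
    v<ᵇy : T (v <ᵇ y)
    v<ᵇy = proj₂ (Equivalence.to (T-∧ {lvψ v ≡ᵇ lvψ y}) (proj₂ (Equivalence.to (T-∧ {wψ v ≡ᵇ wψ y}) full-tie)))

  _↑_ : ℕ → ℕ → Set
  v ↑ p = parent v ≡ p

  _↑*_ : ℕ → ℕ → Set
  _↑*_ = Star _↑_

  ParentsBelow : ℕ → Set
  ParentsBelow k = ∀ {v} → 1 ≤ v → v ≤ k → parent v < v

  ↑*-≤ : ∀ {k v x} → ParentsBelow k → v ↑* x → v ≤ k → x ≤ v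
  ↑*-≤ below ε _ = ≤-refl
  ↑*-≤ {k} {zero}  below (refl ◅ up) v≤k = ↑*-≤ below up z≤n
  ↑*-≤ {k} {suc v} below (refl ◅ up) v≤k =
    ≤-trans (↑*-≤ below up (≤-trans (<⇒≤ p<v) v≤k)) (<⇒≤ p<v)
    where
    p<v : parent (suc v) < suc v
    p<v = below (s≤s z≤n) v≤k

  data DownPath : List ℕ → ℕ → Set where
    end  : ∀ k → DownPath (k ∷ []) k
    step : ∀ {x y ys k} → y ↑ x → x < y → DownPath (y ∷ ys) k → DownPath (x ∷ y ∷ ys) k

  downPath-snoc : ∀ {xs q k} → DownPath xs q → k ↑ q → q < k → DownPath (xs ++ k ∷ []) k
  downPath-snoc (end q)          k↑q q<k = step k↑q q<k (end _)
  downPath-snoc (step y↑x x<y p) k↑q q<k = step y↑x x<y (downPath-snoc p k↑q q<k)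

  downPath-↑* : ∀ {x xs k} → DownPath (x ∷ xs) k → k ↑* x
  downPath-↑* (end _)          = ε
  downPath-↑* (step y↑x _ p)   = downPath-↑* p ◅◅ (y↑x ◅ ε)

  pathTo-downPath : ∀ {K} → ParentsBelow K → ∀ f x → x ≤ K → x ≤ f → DownPath (pathTo (build K) f x) x
  pathTo-downPath below f       zero    _   _   = end 0
  pathTo-downPath {K} below (suc f) (suc x) x≤K x≤f rewrite build-stable {K} (s≤s z≤n) x≤K =
    downPath-snoc (pathTo-downPath below f (parent (suc x)) (≤-trans (<⇒≤ p<x) x≤K) (≤-pred (≤-trans p<x x≤f)))
                  refl p<x
    where
    p<x : parent (suc x) < suc x
    p<x = below (s≤s z≤n) x≤K

  data Attachment (v k q : ℕ) : Set where
    at-end   : q ≡ k → Attachment v k q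
    on-path  : ∀ {y} → k ↑* y → y ↑ q → q < y → T (prec v y) → Attachment v k q

  choose-spec : ∀ v {xs k} → DownPath xs k → k ↑* choose v xs × Attachment v k (choose v xs)
  choose-spec v (end k) = ε , at-end refl
  choose-spec v (step {x} {y} y↑x x<y p) with compat v x | prec v y in v≺y
  ... | true  | true  =
    downPath-↑* (step y↑x x<y p) , on-path (downPath-↑* p) y↑x x<y (Equivalence.from T-≡ v≺y)
  ... | true  | false = choose-spec v p
  ... | false | _     = choose-spec v p

  record Invariant (k : ℕ) : Set where
    field
      parent-<         : ParentsBelow k
      after-ancestor   : ∀ {x v} → k ↑* x → x < v → v ≤ k → x ≤ parent v
      siblings-ordered : ∀ {c c′} → 1 ≤ c → c < c′ → c′ ≤ k → parent c ≡ parent c′ → c ⊏ c′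
      nested           : ∀ {v j} → 1 ≤ v → v < j → j ≤ k → parent j < v → parent j ≤ parent v

  invariant-zero : Invariant 0
  invariant-zero = record
    { parent-<         = λ 1≤v v≤0 → ⊥-elim (<⇒≱ 1≤v v≤0)
    ; after-ancestor   = λ _ x<v v≤0 → ⊥-elim (<⇒≱ (≤-<-trans z≤n x<v) v≤0)
    ; siblings-ordered = λ _ c<c′ c′≤0 → ⊥-elim (<⇒≱ (≤-<-trans z≤n c<c′) c′≤0)
    ; nested           = λ _ v<j j≤0 → ⊥-elim (<⇒≱ (≤-<-trans z≤n v<j) j≤0)
    }

  module Step {k} (inv : Invariant k) where
    open Invariant inv

    attachment-spec : k ↑* parent (suc k) × Attachment (suc k) k (parent (suc k))
    attachment-spec rewrite parent-suc k = choose-spec (suc k) (pathTo-downPath parent-< k k ≤-refl ≤-refl)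

    k↑*q : k ↑* parent (suc k)
    k↑*q = proj₁ attachment-spec

    q≤k : parent (suc k) ≤ k
    q≤k = ↑*-≤ parent-< k↑*q ≤-refl

    parent-<′ : ParentsBelow (suc k)
    parent-<′ 1≤v v≤k+1 with m≤n⇒m<n∨m≡n v≤k+1
    ... | inj₁ v<k+1 = parent-< 1≤v (≤-pred v<k+1)
    ... | inj₂ refl  = s≤s q≤k

    after-ancestor′ : ∀ {x v} → suc k ↑* x → x < v → v ≤ suc k → x ≤ parent v
    after-ancestor′ ε           x<v v≤k+1 = ⊥-elim (<⇒≱ x<v v≤k+1)
    after-ancestor′ (refl ◅ up) x<v v≤k+1 with m≤n⇒m<n∨m≡n v≤k+1
    ... | inj₁ v<k+1 = after-ancestor (k↑*q ◅◅ up) x<v (≤-pred v<k+1)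
    ... | inj₂ refl  = ↑*-≤ parent-< up q≤k

    siblings-ordered′ : ∀ {c c′} → 1 ≤ c → c < c′ → c′ ≤ suc k → parent c ≡ parent c′ → c ⊏ c′
    siblings-ordered′ 1≤c c<c′ c′≤k+1 pc≡pc′ with m≤n⇒m<n∨m≡n c′≤k+1
    siblings-ordered′ 1≤c c<c′ c′≤k+1 pc≡pc′ | inj₁ c′<k+1 =
      siblings-ordered 1≤c c<c′ (≤-pred c′<k+1) pc≡pc′
    siblings-ordered′ {c} 1≤c (s≤s c≤k) c′≤k+1 pc≡q | inj₂ refl with proj₂ attachment-spec
    ... | at-end q≡k = ⊥-elim (<⇒≱ (parent-< 1≤c c≤k) (subst (c ≤_) (sym (trans pc≡q q≡k)) c≤k))
    ... | on-path {y} k↑*y y↑q q<y k+1≺y with <-cmp c y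
    ...   | tri< c<y _ _ = ⊏-trans (siblings-ordered 1≤c c<y (↑*-≤ parent-< k↑*y ≤-refl) (trans pc≡q (sym y↑q)))
                                   (prec⇒⊏ k+1≺y (s≤s (↑*-≤ parent-< k↑*y ≤-refl)))
    ...   | tri≈ _ refl _ = prec⇒⊏ k+1≺y (s≤s c≤k)
    ...   | tri> _ _ y<c = ⊥-elim (<⇒≱ q<y (subst (y ≤_) pc≡q (after-ancestor k↑*y y<c c≤k)))

    nested′ : ∀ {v j} → 1 ≤ v → v < j → j ≤ suc k → parent j < v → parent j ≤ parent v
    nested′ 1≤v v<j j≤k+1 pj<v with m≤n⇒m<n∨m≡n j≤k+1
    ... | inj₁ j<k+1 = nested 1≤v v<j (≤-pred j<k+1) pj<v
    ... | inj₂ refl  = after-ancestor k↑*q pj<v (≤-pred v<j)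

    invariant-suc : Invariant (suc k)
    invariant-suc = record
      { parent-< = parent-<′ ; after-ancestor = after-ancestor′ ; siblings-ordered = siblings-ordered′ ; nested = nested′ }

  invariant : ∀ k → Invariant k
  invariant zero    = invariant-zero
  invariant (suc k) = Step.invariant-suc (invariant k)

  ψ-isPreorderNumbering : Preorder.IsPreorderNumbering (ψ a b)
  ψ-isPreorderNumbering = record
    { parent-<        = parent-<ψ
    ; nested          = nestedψ
    ; siblings-before = siblings-beforeψ
    }
    where
    open Invariant (invariant n)
    parent-<ψ : ∀ {v} → 1 ≤ v → v ≤ n → parentOf (build n) v < v
    parent-<ψ 1≤v v≤n rewrite build-stable 1≤v v≤n = parent-< 1≤v v≤n
    nestedψ : ∀ {v j} → 1 ≤ v → v < j → j ≤ n →
              parentOf (build n) j < v → parentOf (build n) j ≤ parentOf (build n) v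
    nestedψ 1≤v v<j j≤n
      rewrite build-stable (≤-trans 1≤v (<⇒≤ v<j)) j≤n | build-stable 1≤v (≤-trans (<⇒≤ v<j) j≤n) =
      nested 1≤v v<j j≤n
    siblings-beforeψ : ∀ {c c′} → 1 ≤ c → c < c′ → c′ ≤ n →
                       parentOf (build n) c ≡ parentOf (build n) c′ → T (Phi.before (ψ a b) c c′)
    siblings-beforeψ 1≤c c<c′ c′≤n
      rewrite build-stable (≤-trans 1≤c (<⇒≤ c<c′)) c′≤n | build-stable 1≤c (≤-trans (<⇒≤ c<c′) c′≤n) =
      ⊏⇒before ∘ siblings-ordered 1≤c c<c′ c′≤n

module RoundTrip (a : List ℕ) (y : ℕ) (ys : List ℕ) (len : length a ≡ length (y ∷ ys)) where
  b : List ℕ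
  b = y ∷ ys

  open Psi a b
  open Phi (ψ a b) using (visit; Lφ; lφ; lv′)
  open ≡-Reasoning

  visit≡ : visit ≡ range 1 (length a)
  visit≡ = Preorder.visit-preorder (ψ a b) (Construction.ψ-isPreorderNumbering a b)

  visit≡ᵃ : visit ≡ range 1 (length (reverse a))
  visit≡ᵃ = trans visit≡ (cong (range 1) (sym (length-reverse a)))

  visit≡ᵇ : visit ≡ range 1 (length (reverse b))
  visit≡ᵇ = trans visit≡ (cong (range 1) (trans len (sym (length-reverse b))))

  labels : reverse (map wψ visit) ≡ a
  labels = begin
    reverse (map wψ visit)                              ≡⟨ cong (reverse ∘ map wψ) visit≡ᵃ ⟩
    reverse (map wψ (range 1 (length (reverse a))))     ≡⟨ cong reverse (map-range-at (reverse a) (λ _ → refl)) ⟩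
    reverse (reverse a)                                 ≡⟨ reverse-involutive a ⟩
    a                                                   ∎

  levels-visit : map lvψ visit ≡ reverse (map ((L + l) ∸_) b)
  levels-visit = begin
    map lvψ visit                                                ≡⟨ cong (map lvψ) visit≡ᵇ ⟩
    map lvψ (range 1 (length rb))                                ≡⟨ map-range-suc lvψ 0 _ ⟩
    map (((L + l) ∸_) ∘ at rb) (range 0 (length rb))             ≡⟨ map-∘ _ ⟩
    map ((L + l) ∸_) (map (at rb) (range 0 (length rb)))         ≡⟨ cong (map ((L + l) ∸_)) (map-at-range rb) ⟩
    map ((L + l) ∸_) rb                                          ≡⟨ reverse-map ((L + l) ∸_) b ⟩
    reverse (map ((L + l) ∸_) b)                                 ∎
    where
    rb : List ℕ
    rb = reverse b

  Lφ≡ : Lφ ≡ (L + l) ∸ l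
  Lφ≡ = begin
    maxL (map lvψ visit)                 ≡⟨ cong maxL levels-visit ⟩
    maxL (reverse (map ((L + l) ∸_) b))  ≡⟨ maxL-↭ (↭-reverse (map ((L + l) ∸_) b)) ⟩
    maxL (map ((L + l) ∸_) b)            ≡⟨ maxL-map-∸ (L + l) y ys ⟩
    (L + l) ∸ l                          ∎

  lφ≡ : lφ ≡ (L + l) ∸ L
  lφ≡ = begin
    minL (map lvψ visit)                 ≡⟨ cong minL levels-visit ⟩
    minL (reverse (map ((L + l) ∸_) b))  ≡⟨ minL-↭ (↭-reverse (map ((L + l) ∸_) b)) ⟩
    minL (map ((L + l) ∸_) b)            ≡⟨ minL-map-∸ (L + l) y ys ⟩
    (L + l) ∸ L                          ∎

  Lφ+lφ≡L+l : Lφ + lφ ≡ L + l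
  Lφ+lφ≡L+l rewrite Lφ≡ | lφ≡ | m+n∸n≡m L l | m+n∸m≡n L l = refl

  lv′-suc : ∀ i → lv′ (suc i) ≡ at (reverse b) i
  lv′-suc i rewrite Lφ+lφ≡L+l = m∸[m∸n]≡n (≤-trans at≤L (m≤m+n L l))
    where
    at≤L : at (reverse b) i ≤ L
    at≤L = ≤-trans (at-All z≤n (maxL-ub (reverse b)) i) (≤-reflexive (maxL-↭ (↭-reverse b)))

  levels : reverse (map lv′ visit) ≡ b
  levels = begin
    reverse (map lv′ visit)                             ≡⟨ cong (reverse ∘ map lv′) visit≡ᵇ ⟩
    reverse (map lv′ (range 1 (length (reverse b))))    ≡⟨ cong reverse (map-range-at (reverse b) lv′-suc) ⟩
    reverse (reverse b)                                 ≡⟨ reverse-involutive b ⟩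
    b                                                   ∎

φ∘ψ≡id : ∀ a b → length a ≡ length b → φ (ψ a b) ≡ (a , b)
φ∘ψ≡id []      []       _   = refl
φ∘ψ≡id a       (y ∷ ys) len = cong₂ _,_ (RoundTrip.labels a y ys len) (RoundTrip.levels a y ys len)

lemma4p12 : (n : ℕ) → 1 ≤ n → (a b : List ℕ) → zLD2 n a b → φ (ψ a b) ≡ (a , b)
lemma4p12 n _ a b D = φ∘ψ≡id a b (trans (zLD2.len-a D) (sym (zLD2.len-b D)))
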